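{- Let $p\ge1$ be an integer and $g:\{1,\dots,2^p-1\}\to\mathbb{C}$ arbitrary. Let $f:\{1,\dots,2^p-1\}\to\mathbb{C}$ be the solution of the system \[ g(n)=\begin{cases} f(n)-f(2n)-f(2n+1), & 1\le n\le 2^{p-1}-1,\\ f(n), & 2^{p-1}\le n\le 2^p-1.\end{cases} \] Then for every $1\le n\le 2^p-1$, \[ f(n)=\sum_{k=0}^{p-l_{n}}\sum_{l=0}^{2^{k}-1}g\left(2^{k}n+l\right), \] where $l_n=\lfloor\log_2 n\rfloor+1$ is the number of bits in the binary representation of $n$. As a consequence, \[ \sum_{n=1}^{2^{p}-1}s_{2}(n)g(n)=\sum_{n=0}^{2^{p-1}-1}\sum_{k=0}^{p-l_{2n+1}}\sum_{l=0}^{2^{k}-1}g\left(2^{k+1}n+2^{k}+l\right). \]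
   Context: $s_2(n)$ is the number of ones in the binary expansion of $n$. -}

module Defs where

open import Level using (Level)
open import Data.Nat using (ℕ; zero; suc; _+_; _∸_; _%_; _/_)
open import Data.Nat.Logarithm using (⌊log₂_⌋)
open import Algebra.Bundles using (CommutativeRing)

-- s₂ with explicit fuel: digit-sum in base 2 (n % 2 + s₂ (n / 2), s₂ 0 = 0).
-- Fuel n suffices since n has at most n binary digits.
s₂-fuel : ℕ → ℕ → ℕ
s₂-fuel zero     _ = 0
s₂-fuel (suc k)  n = n % 2 + s₂-fuel k (n / 2)

s₂ : ℕ → ℕ
s₂ n = s₂-fuel n n

bits : ℕ → ℕ
bits n = ⌊log₂ n ⌋ + 1

module _ {c ℓ : Level} (R : CommutativeRing c ℓ) where
  open CommutativeRing R using (Carrier; 0#) renaming (_+_ to _+ᴿ_)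

  sumLen : ℕ → ℕ → (ℕ → Carrier) → Carrier
  sumLen a zero    f = 0#
  sumLen a (suc k) f = f a +ᴿ sumLen (suc a) k f

  -- inclusive range sum  Σ_{i = a}^{b} f i   (empty if b < a)
  ∑ : ℕ → ℕ → (ℕ → Carrier) → Carrier
  ∑ a b f = sumLen a (suc b ∸ a) f

  _·_ : ℕ → Carrier → Carrier
  zero  · x = 0#
  suc k · x = x +ᴿ k · x

module _ {c ℓ : Level} (R : CommutativeRing c ℓ) where
  Car : Set c
  Car = CommutativeRing.Carrier R

  eqR : Car → Car → Set ℓ
  eqR = CommutativeRing._≈_ R

  subR : Car → Car → Car
  subR = CommutativeRing._-_ R

-- The numbers 1, …, 2^p - 1 form a complete binary tree rooted at 1 in which n has
-- children 2n and 2n + 1; n has bits n bits, lies on level bits n, and its row k levels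
-- below consists of 2^k n, …, 2^k n + 2^k - 1.  The proof works with the subtree sum
-- tree h n d of h over the d levels below n.

module Submission where

open import Defs
open import Level using (Level)
open import Data.Nat using (ℕ; zero; suc; _+_; _*_; _∸_; _^_; _≤_; _<_; _<?_; >-nonZero; z≤n; s≤s; ⌊_/2⌋; _%_; _/_)
open import Data.Nat.DivMod using (m/n<m; m*n/n≡m; [m+kn]%n≡m%n; m<n⇒m%n≡m; m<n⇒m/n≡0; +-distrib-/-∣ʳ)
open import Data.Nat.Divisibility using (divides-refl)
open import Data.Nat.Logarithm
  using (⌊log₂_⌋; ⌊log₂⌋-mono-≤; ⌊log₂⌊n/2⌋⌋≡⌊log₂n⌋∸1; ⌊log₂[2*b]⌋≡1+⌊log₂b⌋; ⌊log₂[2^n]⌋≡n)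
import Data.Nat.Properties as ℕ
open import Data.Nat.Tactic.RingSolver using (solve-∀)
open import Data.Product using (_×_; _,_)
open import Algebra.Bundles using (CommutativeRing)
open import Relation.Nullary using (yes; no; contradiction)
import Relation.Binary.PropositionalEquality as ≡
open ≡ using (_≡_; cong; cong₂; subst)

double-half≤ : ∀ n → 2 * ⌊ n /2⌋ ≤ n
double-half≤ n = subst (_≤ n) (cong (⌊ n /2⌋ +_) (≡.sym (ℕ.+-identityʳ ⌊ n /2⌋)))
  (subst (⌊ n /2⌋ + ⌊ n /2⌋ ≤_) (ℕ.⌊n/2⌋+⌈n/2⌉≡n n) (ℕ.+-monoʳ-≤ ⌊ n /2⌋ (ℕ.⌊n/2⌋≤⌈n/2⌉ n)))

2^⌊log₂⌋≤ : ∀ n → 1 ≤ n → 2 ^ ⌊log₂ n ⌋ ≤ n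
2^⌊log₂⌋≤ n 1≤n = bound ⌊log₂ n ⌋ n ≡.refl 1≤n
  where
  bound : ∀ L n → ⌊log₂ n ⌋ ≡ L → 1 ≤ n → 2 ^ L ≤ n
  bound zero    n       _  1≤n = 1≤n
  bound (suc L) (suc zero) () _
  bound (suc L) n@(suc (suc m)) eq _ =
    ℕ.≤-trans (ℕ.*-monoʳ-≤ 2 (bound L ⌊ n /2⌋ (≡.trans (⌊log₂⌊n/2⌋⌋≡⌊log₂n⌋∸1 n) (cong (_∸ 1) eq)) (s≤s z≤n)))
              (double-half≤ n)

2^-cancel-< : ∀ m n → 2 ^ m < 2 ^ n → m < n
2^-cancel-< m n 2^m<2^n with m <? n
... | yes m<n = m<n
... | no  m≮n = contradiction (ℕ.^-monoʳ-≤ 2 (ℕ.≮⇒≥ m≮n)) (ℕ.<⇒≱ 2^m<2^n)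

<2^suc⌊log₂⌋ : ∀ n → n < 2 ^ suc ⌊log₂ n ⌋
<2^suc⌊log₂⌋ n with n <? 2 ^ suc ⌊log₂ n ⌋
... | yes n<2^L = n<2^L
... | no  n≮2^L = contradiction
  (subst (_≤ ⌊log₂ n ⌋) (⌊log₂[2^n]⌋≡n (suc ⌊log₂ n ⌋)) (⌊log₂⌋-mono-≤ (ℕ.≮⇒≥ n≮2^L)))
  (ℕ.<⇒≱ (ℕ.n<1+n ⌊log₂ n ⌋))

⌊log₂⌋-unique : ∀ L n → 2 ^ L ≤ n → n < 2 ^ suc L → ⌊log₂ n ⌋ ≡ L
⌊log₂⌋-unique L n 2^L≤n n<2^L' = ℕ.≤-antisym
  (ℕ.≤-pred (2^-cancel-< ⌊log₂ n ⌋ (suc L) (ℕ.≤-<-trans (2^⌊log₂⌋≤ n 1≤n) n<2^L')))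
  (subst (_≤ ⌊log₂ n ⌋) (⌊log₂[2^n]⌋≡n L) (⌊log₂⌋-mono-≤ 2^L≤n))
  where
  1≤n : 1 ≤ n
  1≤n = ℕ.≤-trans (ℕ.m^n>0 2 L) 2^L≤n

2^[bits∸1]≤ : ∀ n → 1 ≤ n → 2 ^ (bits n ∸ 1) ≤ n
2^[bits∸1]≤ n 1≤n = subst (λ L → 2 ^ L ≤ n) (≡.sym (ℕ.m+n∸n≡m ⌊log₂ n ⌋ 1)) (2^⌊log₂⌋≤ n 1≤n)

<2^bits : ∀ n → n < 2 ^ bits n
<2^bits n = subst (λ L → n < 2 ^ L) (ℕ.+-comm 1 ⌊log₂ n ⌋) (<2^suc⌊log₂⌋ n)

bits≤ : ∀ n q → 1 ≤ n → n < 2 ^ q → bits n ≤ q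
bits≤ n q 1≤n n<2^q = subst (_≤ q) (ℕ.+-comm 1 ⌊log₂ n ⌋)
  (2^-cancel-< ⌊log₂ n ⌋ q (ℕ.≤-<-trans (2^⌊log₂⌋≤ n 1≤n) n<2^q))

bits-double : ∀ n → 1 ≤ n → bits (2 * n) ≡ suc (bits n)
bits-double n 1≤n = cong (_+ 1) (⌊log₂[2*b]⌋≡1+⌊log₂b⌋ n {{>-nonZero 1≤n}})

bits-double+1 : ∀ n → 1 ≤ n → bits (2 * n + 1) ≡ suc (bits n)
bits-double+1 n 1≤n = cong (_+ 1) (⌊log₂⌋-unique (suc ⌊log₂ n ⌋) (2 * n + 1) lower upper)
  where
  lower : 2 ^ suc ⌊log₂ n ⌋ ≤ 2 * n + 1
  lower = ℕ.≤-trans (ℕ.*-monoʳ-≤ 2 (2^⌊log₂⌋≤ n 1≤n)) (ℕ.m≤m+n (2 * n) 1)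
  upper : 2 * n + 1 < 2 ^ suc (suc ⌊log₂ n ⌋)
  upper = ℕ.<-≤-trans (ℕ.+-monoʳ-< (2 * n) (s≤s (s≤s z≤n)))
    (subst (_≤ 2 ^ suc (suc ⌊log₂ n ⌋)) (≡.trans (ℕ.*-suc 2 n) (ℕ.+-comm 2 (2 * n)))
      (ℕ.*-monoʳ-≤ 2 (<2^suc⌊log₂⌋ n)))
s₂-fuel-irrelevant : ∀ j k n → n ≤ j → n ≤ k → s₂-fuel j n ≡ s₂-fuel k n
s₂-fuel-irrelevant zero    zero    n z≤n _   = ≡.refl
s₂-fuel-irrelevant zero    (suc k) n z≤n _   = s₂-fuel-irrelevant zero k 0 z≤n z≤n
s₂-fuel-irrelevant (suc j) zero    n _   z≤n = s₂-fuel-irrelevant j zero 0 z≤n z≤n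
s₂-fuel-irrelevant (suc j) (suc k) n n≤j n≤k =
  cong (n % 2 +_) (s₂-fuel-irrelevant j k (n / 2) (half≤ n≤j) (half≤ n≤k))
  where
  half≤ : ∀ {n i} → n ≤ suc i → n / 2 ≤ i
  half≤ {zero}  _   = z≤n
  half≤ {suc m} m<i = ℕ.≤-pred (ℕ.≤-trans (m/n<m (suc m) 2 (s≤s (s≤s z≤n))) m<i)

s₂-step : ∀ n → s₂ n ≡ n % 2 + s₂ (n / 2)
s₂-step zero    = ≡.refl
s₂-step (suc m) = cong (suc m % 2 +_)
  (s₂-fuel-irrelevant m (suc m / 2) (suc m / 2) (ℕ.≤-pred (m/n<m (suc m) 2 (s≤s (s≤s z≤n)))) ℕ.≤-refl)

s₂-append : ∀ n b → b < 2 → s₂ (b + n * 2) ≡ b + s₂ n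
s₂-append n b b<2 = ≡.trans (s₂-step (b + n * 2)) (cong₂ (λ r q → r + s₂ q) last rest)
  where
  last : (b + n * 2) % 2 ≡ b
  last = ≡.trans ([m+kn]%n≡m%n b n 2) (m<n⇒m%n≡m b<2)
  rest : (b + n * 2) / 2 ≡ n
  rest = ≡.trans (+-distrib-/-∣ʳ b (divides-refl n)) (cong₂ _+_ (m<n⇒m/n≡0 b<2) (m*n/n≡m n 2))

s₂-double : ∀ n → s₂ (2 * n) ≡ s₂ n
s₂-double n = ≡.trans (cong s₂ (ℕ.*-comm 2 n)) (s₂-append n 0 (s≤s z≤n))

s₂-double+1 : ∀ n → s₂ (2 * n + 1) ≡ suc (s₂ n)
s₂-double+1 n = ≡.trans (cong s₂ (≡.trans (ℕ.+-comm (2 * n) 1) (cong suc (ℕ.*-comm 2 n)))) (s₂-append n 1 (s≤s (s≤s z≤n)))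

-- Heights: a node with b bits lies at height d below level p when b + d = p.
-- A child (one bit more) of a node at height d + 1 lies at height d.
child-height : ∀ {b b′ d p} → b′ ≡ suc b → b + suc d ≡ p → b′ + d ≡ p
child-height {b} {d = d} ≡.refl height = ≡.trans (≡.sym (ℕ.+-suc b d)) height

remaining-depth : ∀ {b d q} → b + d ≡ q → q ∸ b ≡ d
remaining-depth {b} {d} ≡.refl = ℕ.m+n∸m≡n b d

1≤double : ∀ {n} → 1 ≤ n → 1 ≤ 2 * n
1≤double {n} 1≤n = ℕ.≤-trans 1≤n (ℕ.m≤m+n n _)

1≤double+1 : ∀ n → 1 ≤ 2 * n + 1
1≤double+1 n = ℕ.m≤n+m 1 (2 * n)

-- Index arithmetic for the two halves of a row of the tree:
-- position l of the first / second half of row k + 1 below n.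
first-half : ∀ x n → 2 * x * n ≡ x * (2 * n)
first-half = solve-∀

second-half : ∀ x n l → 2 * x * n + (x + l) ≡ x * (2 * n + 1) + l
second-half = solve-∀

-- Index of position l in row k below the odd node 2n + 1.
odd-row-index : ∀ x n l → x * 2 * n + x + l ≡ x * (2 * n + 1) + l
odd-row-index = solve-∀

-- (x - 1) + x = 2x - 1 for x ≥ 1; with x = 2^(d+1) this joins the ranges of two levels.
pred-double : ∀ x → 1 ≤ x → (x ∸ 1) + x ≡ 2 * x ∸ 1
pred-double (suc x) _ = cong (x +_) (≡.sym (ℕ.+-identityʳ (suc x)))

module Sums {c ℓ : Level} (R : CommutativeRing c ℓ) where
  open CommutativeRing R
    using (Carrier; 0#; _≈_; setoid; refl; sym; trans; reflexive; +-cong; +-assoc; +-comm;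
           +-identityˡ; +-identityʳ; +-group; +-commutativeSemigroup)
    renaming (_+_ to _⊕_)
  open import Algebra.Properties.CommutativeSemigroup +-commutativeSemigroup using (interchange)
  open import Algebra.Properties.Group +-group using (//-rightDividesˡ)
  open import Relation.Binary.Reasoning.Setoid setoid

  Σ : ℕ → ℕ → (ℕ → Carrier) → Carrier
  Σ = sumLen R

  infixr 8 _·ᴿ_
  _·ᴿ_ : ℕ → Carrier → Carrier
  _·ᴿ_ = _·_ R

  ≈-reindex : ∀ (f g : ℕ → Carrier) {i i′ j j′} → i ≡ i′ → j ≡ j′ → f i′ ≈ g j′ → f i ≈ g j
  ≈-reindex f g i≡i′ j≡j′ eq = trans (reflexive (cong f i≡i′)) (trans eq (reflexive (cong g (≡.sym j≡j′))))

  Σ-cong : ∀ m a b (f g : ℕ → Carrier) → (∀ i → f (a + i) ≈ g (b + i)) → Σ a m f ≈ Σ b m g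
  Σ-cong zero    a b f g f≈g = refl
  Σ-cong (suc m) a b f g f≈g = +-cong
    (≈-reindex f g (≡.sym (ℕ.+-identityʳ a)) (≡.sym (ℕ.+-identityʳ b)) (f≈g 0))
    (Σ-cong m (suc a) (suc b) f g (λ i → ≈-reindex f g (≡.sym (ℕ.+-suc a i)) (≡.sym (ℕ.+-suc b i)) (f≈g (suc i))))

  Σ-+ : ∀ m a (f g : ℕ → Carrier) → Σ a m (λ i → f i ⊕ g i) ≈ Σ a m f ⊕ Σ a m g
  Σ-+ zero    a f g = sym (+-identityʳ 0#)
  Σ-+ (suc m) a f g = trans (+-cong refl (Σ-+ m (suc a) f g)) (interchange _ _ _ _)

  Σ-++ : ∀ m n a (f : ℕ → Carrier) → Σ a (m + n) f ≈ Σ a m f ⊕ Σ (a + m) n f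
  Σ-++ zero    n a f = sym (trans (+-identityˡ _) (reflexive (cong (λ b → Σ b n f) (ℕ.+-identityʳ a))))
  Σ-++ (suc m) n a f = begin
    f a ⊕ Σ (suc a) (m + n) f                   ≈⟨ +-cong refl (Σ-++ m n (suc a) f) ⟩
    f a ⊕ (Σ (suc a) m f ⊕ Σ (suc a + m) n f)   ≈⟨ +-assoc _ _ _ ⟨
    Σ a (suc m) f ⊕ Σ (suc a + m) n f           ≈⟨ +-cong refl (reflexive (cong (λ b → Σ b n f) (≡.sym (ℕ.+-suc a m)))) ⟩
    Σ a (suc m) f ⊕ Σ (a + suc m) n f           ∎

  Σ-snoc : ∀ m a (f : ℕ → Carrier) → Σ a (suc m) f ≈ Σ a m f ⊕ f (a + m)
  Σ-snoc m a f = begin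
    Σ a (suc m) f               ≡⟨ cong (λ k → Σ a k f) (ℕ.+-comm 1 m) ⟩
    Σ a (m + 1) f               ≈⟨ Σ-++ m 1 a f ⟩
    Σ a m f ⊕ (f (a + m) ⊕ 0#)  ≈⟨ +-cong refl (+-identityʳ _) ⟩
    Σ a m f ⊕ f (a + m)         ∎

  ·-distrib : ∀ k x y → k ·ᴿ (x ⊕ y) ≈ k ·ᴿ x ⊕ k ·ᴿ y
  ·-distrib zero    x y = sym (+-identityʳ 0#)
  ·-distrib (suc k) x y = trans (+-cong refl (·-distrib k x y)) (interchange _ _ _ _)

  solve-for : ∀ x a b g → g ≈ subR R (subR R x a) b → x ≈ g ⊕ (a ⊕ b)
  solve-for x a b g g≈ = sym (begin
    g ⊕ (a ⊕ b)                                 ≈⟨ +-cong g≈ (+-comm a b) ⟩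
    subR R (subR R x a) b ⊕ (b ⊕ a)             ≈⟨ +-assoc _ _ _ ⟨
    (subR R (subR R x a) b ⊕ b) ⊕ a             ≈⟨ +-cong (//-rightDividesˡ b _) refl ⟩
    subR R x a ⊕ a                              ≈⟨ //-rightDividesˡ a x ⟩
    x                                           ∎)

module Trees {c ℓ : Level} (R : CommutativeRing c ℓ) where
  open CommutativeRing R
    using (Carrier; 0#; _≈_; setoid; refl; sym; trans; reflexive; +-cong; +-identityʳ; +-commutativeMonoid)
    renaming (_+_ to _⊕_)
  open Sums R
  open import Algebra.Solver.CommutativeMonoid +-commutativeMonoid using (solve; _⊜_) renaming (_⊕_ to _⊞_)
  open import Relation.Binary.Reasoning.Setoid setoid

  tree : (ℕ → Carrier) → ℕ → ℕ → Carrier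
  tree h n zero    = h n
  tree h n (suc d) = h n ⊕ (tree h (2 * n) d ⊕ tree h (2 * n + 1) d)

  row : (ℕ → Carrier) → ℕ → ℕ → Carrier
  row h n k = Σ 0 (2 ^ k) (λ l → h (2 ^ k * n + l))

  row-zero : ∀ h n → row h n 0 ≈ h n
  row-zero h n = trans (+-identityʳ _) (reflexive (cong h (≡.trans (ℕ.+-identityʳ (1 * n)) (ℕ.*-identityˡ n))))

  row-suc : ∀ h n k → row h n (suc k) ≈ row h (2 * n) k ⊕ row h (2 * n + 1) k
  row-suc h n k = begin
    Σ 0 (2 ^ k + (2 ^ k + 0)) F       ≡⟨ cong (λ m → Σ 0 (2 ^ k + m) F) (ℕ.+-identityʳ (2 ^ k)) ⟩
    Σ 0 (2 ^ k + 2 ^ k) F             ≈⟨ Σ-++ (2 ^ k) (2 ^ k) 0 F ⟩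
    Σ 0 (2 ^ k) F ⊕ Σ (2 ^ k) (2 ^ k) F
      ≈⟨ +-cong (Σ-cong (2 ^ k) 0 0 F _ (λ l → reflexive (cong (λ m → h (m + l)) (first-half (2 ^ k) n))))
                (Σ-cong (2 ^ k) (2 ^ k) 0 F _ (λ l → reflexive (cong h (second-half (2 ^ k) n l)))) ⟩
    row h (2 * n) k ⊕ row h (2 * n + 1) k ∎
    where
    F : ℕ → Carrier
    F l = h (2 ^ suc k * n + l)

  tree-rows : ∀ h d n → tree h n d ≈ Σ 0 (suc d) (row h n)
  tree-rows h zero    n = sym (trans (+-identityʳ _) (row-zero h n))
  tree-rows h (suc d) n = begin
    h n ⊕ (tree h (2 * n) d ⊕ tree h (2 * n + 1) d)
      ≈⟨ +-cong refl (+-cong (tree-rows h d (2 * n)) (tree-rows h d (2 * n + 1))) ⟩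
    h n ⊕ (Σ 0 (suc d) (row h (2 * n)) ⊕ Σ 0 (suc d) (row h (2 * n + 1)))
      ≈⟨ +-cong refl (Σ-+ (suc d) 0 (row h (2 * n)) (row h (2 * n + 1))) ⟨
    h n ⊕ Σ 0 (suc d) (λ k → row h (2 * n) k ⊕ row h (2 * n + 1) k)
      ≈⟨ +-cong (row-zero h n) (Σ-cong (suc d) 1 0 (row h n) _ (row-suc h n)) ⟨
    row h n 0 ⊕ Σ 1 (suc d) (row h n) ∎

  tree-formula : ∀ h d n → tree h n d ≈ ∑ R 0 d (λ k → ∑ R 0 (2 ^ k ∸ 1) (λ l → h (2 ^ k * n + l)))
  tree-formula h d n = trans (tree-rows h d n) (Σ-cong (suc d) 0 0 _ _
    (λ k → reflexive (cong (λ m → Σ 0 m (λ l → h (2 ^ k * n + l))) (≡.sym (ℕ.suc-pred (2 ^ k) {{ℕ.m^n≢0 2 k}})))))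

  row-root : ∀ h k → row h 1 k ≈ Σ (2 ^ k) (2 ^ k) h
  row-root h k = Σ-cong (2 ^ k) 0 (2 ^ k) _ h (λ l → reflexive (cong (λ m → h (m + l)) (ℕ.*-identityʳ (2 ^ k))))

  tree-root : ∀ h d → tree h 1 d ≈ Σ 1 (2 ^ suc d ∸ 1) h
  tree-root h d = trans (tree-rows h d 1) (rows-root d)
    where
    rows-root : ∀ d → Σ 0 (suc d) (row h 1) ≈ Σ 1 (2 ^ suc d ∸ 1) h
    rows-root zero    = +-identityʳ _
    rows-root (suc d) = begin
      Σ 0 (suc (suc d)) (row h 1)                  ≈⟨ Σ-snoc (suc d) 0 (row h 1) ⟩
      Σ 0 (suc d) (row h 1) ⊕ row h 1 (suc d)      ≈⟨ +-cong (rows-root d) (row-root h (suc d)) ⟩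
      Σ 1 (x ∸ 1) h ⊕ Σ x x h                      ≡⟨ cong (λ a → Σ 1 (x ∸ 1) h ⊕ Σ a x h) (≡.sym (ℕ.suc-pred x {{ℕ.m^n≢0 2 (suc d)}})) ⟩
      Σ 1 (x ∸ 1) h ⊕ Σ (1 + (x ∸ 1)) x h          ≈⟨ Σ-++ (x ∸ 1) x 1 h ⟨
      Σ 1 ((x ∸ 1) + x) h                          ≡⟨ cong (λ m → Σ 1 m h) (pred-double x (ℕ.m^n>0 2 (suc d))) ⟩
      Σ 1 (2 ^ suc (suc d) ∸ 1) h                  ∎
      where
      x : ℕ
      x = 2 ^ suc d

  -- treeᴰ K n d: like tree, but node m contributes K m e, where e is its remaining depth.
  treeᴰ : (ℕ → ℕ → Carrier) → ℕ → ℕ → Carrier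
  treeᴰ K n zero    = K n zero
  treeᴰ K n (suc d) = K n (suc d) ⊕ (treeᴰ K (2 * n) d ⊕ treeᴰ K (2 * n + 1) d)

  -- Below a node of height d under level q, the remaining depth of m is q - bits m,
  -- so a depth-dependent tree sum is an ordinary one.
  treeᴰ-height : ∀ q K d n → 1 ≤ n → bits n + d ≡ q → treeᴰ K n d ≈ tree (λ m → K m (q ∸ bits m)) n d
  treeᴰ-height q K zero    n _   height = reflexive (cong (K n) (≡.sym (remaining-depth height)))
  treeᴰ-height q K (suc d) n 1≤n height = +-cong
    (reflexive (cong (K n) (≡.sym (remaining-depth height))))
    (+-cong (treeᴰ-height q K d (2 * n) (1≤double 1≤n) (child-height (bits-double n 1≤n) height))
            (treeᴰ-height q K d (2 * n + 1) (1≤double+1 n) (child-height (bits-double+1 n 1≤n) height)))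

  -- oddSubtrees h n d: the sum, over all odd nodes 2j + 1 strictly below n up to depth d,
  -- of h summed over the part of the subtree of 2j + 1 lying within depth d below n.
  oddSubtrees : (ℕ → Carrier) → ℕ → ℕ → Carrier
  oddSubtrees h n zero    = 0#
  oddSubtrees h n (suc d) = treeᴰ (λ j e → tree h (2 * j + 1) e) n d

  oddSubtrees-suc : ∀ h n d →
    oddSubtrees h n (suc d) ≈ tree h (2 * n + 1) d ⊕ (oddSubtrees h (2 * n) d ⊕ oddSubtrees h (2 * n + 1) d)
  oddSubtrees-suc h n zero    = sym (trans (+-cong refl (+-identityʳ 0#)) (+-identityʳ _))
  oddSubtrees-suc h n (suc d) = refl

  -- s₂ m exceeds s₂ n by the number of odd nodes on the path from n down to m, so
  -- weighting a subtree sum by s₂ adds the sums over all odd subtrees below n.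
  weighted-tree : ∀ h d n → tree (λ m → s₂ m ·ᴿ h m) n d ≈ s₂ n ·ᴿ tree h n d ⊕ oddSubtrees h n d
  weighted-tree h zero    n = sym (+-identityʳ _)
  weighted-tree h (suc d) n = begin
    w ·ᴿ h n ⊕ (tree sh (2 * n) d ⊕ tree sh (2 * n + 1) d)
      ≈⟨ +-cong refl (+-cong (weighted-tree h d (2 * n)) (weighted-tree h d (2 * n + 1))) ⟩
    w ·ᴿ h n ⊕ ((s₂ (2 * n) ·ᴿ T₀ ⊕ O₀) ⊕ (s₂ (2 * n + 1) ·ᴿ T₁ ⊕ O₁))
      ≡⟨ cong₂ (λ a b → w ·ᴿ h n ⊕ ((a ·ᴿ T₀ ⊕ O₀) ⊕ (b ·ᴿ T₁ ⊕ O₁))) (s₂-double n) (s₂-double+1 n) ⟩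
    w ·ᴿ h n ⊕ ((w ·ᴿ T₀ ⊕ O₀) ⊕ ((T₁ ⊕ w ·ᴿ T₁) ⊕ O₁))
      ≈⟨ regroup (w ·ᴿ h n) (w ·ᴿ T₀) (w ·ᴿ T₁) T₁ O₀ O₁ ⟩
    (w ·ᴿ h n ⊕ (w ·ᴿ T₀ ⊕ w ·ᴿ T₁)) ⊕ (T₁ ⊕ (O₀ ⊕ O₁))
      ≈⟨ +-cong (trans (·-distrib w (h n) _) (+-cong refl (·-distrib w T₀ T₁))) (oddSubtrees-suc h n d) ⟨
    w ·ᴿ tree h n (suc d) ⊕ oddSubtrees h n (suc d) ∎
    where
    sh : ℕ → Carrier
    sh m = s₂ m ·ᴿ h m
    w : ℕ
    w = s₂ n
    T₀ T₁ O₀ O₁ : Carrier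
    T₀ = tree h (2 * n) d
    T₁ = tree h (2 * n + 1) d
    O₀ = oddSubtrees h (2 * n) d
    O₁ = oddSubtrees h (2 * n + 1) d
    regroup : ∀ a b c t x y → a ⊕ ((b ⊕ x) ⊕ ((t ⊕ c) ⊕ y)) ≈ (a ⊕ (b ⊕ c)) ⊕ (t ⊕ (x ⊕ y))
    regroup = solve 6 (λ a b c t x y → a ⊞ ((b ⊞ x) ⊞ ((t ⊞ c) ⊞ y)) ⊜ (a ⊞ (b ⊞ c)) ⊞ (t ⊞ (x ⊞ y))) refl

module System {c ℓ : Level} (R : CommutativeRing c ℓ) (p : ℕ) (f g : ℕ → Car R)
  (internal : ∀ n → 1 ≤ n → n ≤ 2 ^ (p ∸ 1) ∸ 1 →
    eqR R (g n) (subR R (subR R (f n) (f (2 * n))) (f (2 * n + 1))))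
  (leaf : ∀ n → 2 ^ (p ∸ 1) ≤ n → n ≤ 2 ^ p ∸ 1 → eqR R (g n) (f n)) where
  open CommutativeRing R using (_≈_; sym; trans; refl; +-cong)
  open Sums R
  open Trees R

  -- By induction on the height d of n: a node of height 0 is a leaf, any other node is
  -- internal and f n = g n + f(2n) + f(2n+1).
  f-tree : ∀ d n → 1 ≤ n → bits n + d ≡ p → f n ≈ tree g n d
  f-tree zero n 1≤n height = sym (leaf n lower upper)
    where
    bits≡p : bits n ≡ p
    bits≡p = ≡.trans (≡.sym (ℕ.+-identityʳ (bits n))) height
    lower : 2 ^ (p ∸ 1) ≤ n
    lower = subst (λ b → 2 ^ (b ∸ 1) ≤ n) bits≡p (2^[bits∸1]≤ n 1≤n)
    upper : n ≤ 2 ^ p ∸ 1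
    upper = ℕ.<⇒≤pred (subst (λ b → n < 2 ^ b) bits≡p (<2^bits n))
  f-tree (suc d) n 1≤n height = trans (solve-for _ _ _ _ (internal n 1≤n internal-node))
    (+-cong refl (+-cong (f-tree d (2 * n) (1≤double 1≤n) (child-height (bits-double n 1≤n) height))
                         (f-tree d (2 * n + 1) (1≤double+1 n) (child-height (bits-double+1 n 1≤n) height))))
    where
    bits<p : bits n ≤ p ∸ 1
    bits<p = ℕ.<⇒≤pred (subst (bits n <_) height (ℕ.m<m+n (bits n) (s≤s z≤n)))
    internal-node : n ≤ 2 ^ (p ∸ 1) ∸ 1
    internal-node = ℕ.<⇒≤pred (ℕ.<-≤-trans (<2^bits n) (ℕ.^-monoʳ-≤ 2 bits<p))

  -- Every node 1 ≤ n < 2^p has at most p bits, hence height p - bits n.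
  f-formula : ∀ n → 1 ≤ n → n ≤ 2 ^ p ∸ 1 →
    f n ≈ ∑ R 0 (p ∸ bits n) (λ k → ∑ R 0 (2 ^ k ∸ 1) (λ l → g (2 ^ k * n + l)))
  f-formula n 1≤n n≤2^p-1 = trans (f-tree (p ∸ bits n) n 1≤n (ℕ.m+[n∸m]≡n bits≤p)) (tree-formula g (p ∸ bits n) n)
    where
    bits≤p : bits n ≤ p
    bits≤p = bits≤ n p 1≤n (ℕ.m≤pred[n]⇒suc[m]≤n {{ℕ.m^n≢0 2 p}} n≤2^p-1)

-- The second claim, for p = e + 1: the weighted sum over the tree on 1, …, 2^p - 1 is the
-- sum of the subtree sums below its odd nodes 2j + 1 (including the root 1, for j = 0).
module WeightedSum {c ℓ : Level} (R : CommutativeRing c ℓ) (e : ℕ) (g : ℕ → Car R) where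
  open CommutativeRing R using (Carrier; _≈_; setoid; sym; trans; refl; reflexive; +-cong; +-identityʳ)
    renaming (_+_ to _⊕_)
  open Sums R
  open Trees R
  open import Relation.Binary.Reasoning.Setoid setoid

  oddTree : ℕ → ℕ → Carrier
  oddTree q j = tree g (2 * j + 1) (q ∸ bits (2 * j + 1))

  odd-root : ∀ q → oddSubtrees g 1 q ≈ Σ 1 (2 ^ q ∸ 1) (oddTree (suc q))
  odd-root zero    = refl
  odd-root (suc q) = begin
    treeᴰ K 1 q                                  ≈⟨ treeᴰ-height (suc q) K q 1 (s≤s z≤n) ≡.refl ⟩
    tree (λ j → K j (suc q ∸ bits j)) 1 q        ≈⟨ tree-root _ q ⟩
    Σ 1 (2 ^ suc q ∸ 1) (λ j → K j (suc q ∸ bits j))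
      ≈⟨ Σ-cong (2 ^ suc q ∸ 1) 1 1 _ _ (λ i → reflexive (cong (λ b → K (suc i) (suc (suc q) ∸ b))
                                                        (≡.sym (bits-double+1 (suc i) (s≤s z≤n))))) ⟩
    Σ 1 (2 ^ suc q ∸ 1) (oddTree (suc (suc q)))  ∎
    where
    K : ℕ → ℕ → Carrier
    K j d = tree g (2 * j + 1) d

  oddTree-formula : ∀ j → oddTree (suc e) j ≈
    ∑ R 0 (suc e ∸ bits (2 * j + 1)) (λ k → ∑ R 0 (2 ^ k ∸ 1) (λ l → g (2 ^ (k + 1) * j + 2 ^ k + l)))
  oddTree-formula j = trans (tree-formula g (suc e ∸ bits (2 * j + 1)) (2 * j + 1))
    (Σ-cong (suc (suc e ∸ bits (2 * j + 1))) 0 0 _ _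
      (λ k → Σ-cong (suc (2 ^ k ∸ 1)) 0 0 _ _ (λ l → reflexive (cong g (≡.sym (index k l))))))
    where
    index : ∀ k l → 2 ^ (k + 1) * j + 2 ^ k + l ≡ 2 ^ k * (2 * j + 1) + l
    index k l = ≡.trans (cong (λ x → x * j + 2 ^ k + l) (ℕ.^-distribˡ-+-* 2 k 1)) (odd-row-index (2 ^ k) j l)

  weighted-sum : ∑ R 1 (2 ^ suc e ∸ 1) (λ n → s₂ n ·ᴿ g n) ≈
    ∑ R 0 (2 ^ (suc e ∸ 1) ∸ 1) (λ j → ∑ R 0 (suc e ∸ bits (2 * j + 1))
      (λ k → ∑ R 0 (2 ^ k ∸ 1) (λ l → g (2 ^ (k + 1) * j + 2 ^ k + l))))
  weighted-sum = begin
    Σ 1 (2 ^ suc e ∸ 1) (λ n → s₂ n ·ᴿ g n)                 ≈⟨ tree-root _ e ⟨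
    tree (λ n → s₂ n ·ᴿ g n) 1 e                             ≈⟨ weighted-tree g e 1 ⟩
    s₂ 1 ·ᴿ tree g 1 e ⊕ oddSubtrees g 1 e                   ≈⟨ +-cong (+-identityʳ _) (odd-root e) ⟩
    Σ 0 (suc (2 ^ e ∸ 1)) (oddTree (suc e))                  ≈⟨ Σ-cong (suc (2 ^ e ∸ 1)) 0 0 _ _ oddTree-formula ⟩
    _                                                        ∎

theorem28 : {c ℓ : Level} (R : CommutativeRing c ℓ) →
    (p : ℕ) → 1 ≤ p → (f g : ℕ → Car R) →
    (∀ n → 1 ≤ n → n ≤ 2 ^ (p ∸ 1) ∸ 1 →
      eqR R (g n) (subR R (subR R (f n) (f (2 * n))) (f (2 * n + 1)))) →
    (∀ n → 2 ^ (p ∸ 1) ≤ n → n ≤ 2 ^ p ∸ 1 → eqR R (g n) (f n)) →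
    (∀ n → 1 ≤ n → n ≤ 2 ^ p ∸ 1 →
      eqR R (f n) (∑ R 0 (p ∸ bits n) (λ k → ∑ R 0 (2 ^ k ∸ 1) (λ l → g (2 ^ k * n + l)))))
    ×
    eqR R (∑ R 1 (2 ^ p ∸ 1) (λ n → _·_ R (s₂ n) (g n)))
      (∑ R 0 (2 ^ (p ∸ 1) ∸ 1) (λ n → ∑ R 0 (p ∸ bits (2 * n + 1))
          (λ k → ∑ R 0 (2 ^ k ∸ 1) (λ l → g (2 ^ (k + 1) * n + 2 ^ k + l)))))
theorem28 R (suc e) _ f g internal leaf =
  System.f-formula R (suc e) f g internal leaf , WeightedSum.weighted-sum R e g
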